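{- For every integer $a\geq 3$ and every integer $m\geq 3$, the 2-color Rado number of the equation $x_1+x_2+\cdots+x_{m-1}=ax_m$ is at least $C(m,a)=\left\lceil\frac{m-1}{a}\left\lceil\frac{m-1}{a}\right\rceil\right\rceil$.
   Context: For an integer $n\ge 1$ let $[n]=\{1,\ldots,n\}$. A solution of the equation in $[n]$ is an assignment of values in $[n]$ to $x_1,\ldots,x_m$ (not necessarily distinct) making the equation true; given a coloring of $[n]$, the solution is monochromatic if all the values $x_1,\ldots,x_m$ receive the same color. The 2-color Rado number of the equation (which exists for $m\ge 3$) is the smallest positive integer $n$ such that every coloring of $[n]$ with two colors admits a monochromatic solution in $[n]$. -}

module Defs where

open import Data.Nat using (ℕ; zero; suc; _+_; _*_; _∸_; _≤_; _<_)
open import Data.Nat.DivMod using (_/_)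
open import Data.Bool using (Bool)
open import Data.Fin using (Fin; inject₁; fromℕ)
open import Data.Product using (Σ; _×_)
open import Relation.Binary.PropositionalEquality using (_≡_)

sumFin : (k : ℕ) → (Fin k → ℕ) → ℕ
sumFin zero f = 0
sumFin (suc k) f = f Data.Fin.zero + sumFin k (λ i → f (Data.Fin.suc i))

-- The equation x_1 + ... + x_{k} = a * x_{k+1}, with m = k + 1 variables
-- indexed by Fin (suc k); the last variable is  fromℕ k.
IsSolution : (a k : ℕ) → (Fin (suc k) → ℕ) → Set
IsSolution a k x = sumFin k (λ i → x (inject₁ i)) ≡ a * x (fromℕ k)

InRange : (n k : ℕ) → (Fin (suc k) → ℕ) → Set
InRange n k x = ∀ i → 1 ≤ x i × x i ≤ n

Monochromatic : (col : ℕ → Bool) (c : Bool) (k : ℕ) → (Fin (suc k) → ℕ) → Set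
Monochromatic col c k x = ∀ i → col (x i) ≡ c

-- A colouring of [n] is represented by any function ℕ → Bool (only its
-- values on [n] matter, since solutions lie in [n]).
RadoProperty : (a m n : ℕ) → Set
RadoProperty a m n =
  (col : ℕ → Bool) →
  Σ Bool λ c → Σ (Fin (suc (m ∸ 1)) → ℕ) λ x →
    InRange n (m ∸ 1) x × IsSolution a (m ∸ 1) x × Monochromatic col c (m ∸ 1) x

ceilDiv : ℕ → (q : ℕ) → ℕ
ceilDiv p zero = 0
ceilDiv p (suc q) = (p + q) / suc q

C : ℕ → ℕ → ℕ
C m a = ceilDiv ((m ∸ 1) * ceilDiv (m ∸ 1) a) a

module Submission where

-- Put t = ⌈k/a⌉ and colour [n] by a threshold: x is red when x < t and blue
-- when x ≥ t.  In any solution whose first k variables are all at least lb,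
-- the equation gives a·x_{k+1} ≥ k·lb, hence x_{k+1} ≥ ⌈k·lb/a⌉.
--   * A red solution has lb = 1, so x_{k+1} ≥ ⌈k/a⌉ = t; but x_{k+1} is red,
--     i.e. x_{k+1} < t — impossible.
--   * A blue solution has lb = t, so n ≥ x_{k+1} ≥ ⌈k·t/a⌉ = C(m,a).
-- Hence if every 2-colouring of [n] has a monochromatic solution, the one
-- produced for the threshold colouring is blue and C(m,a) ≤ n.

open import Defs
open import Data.Nat using (ℕ; zero; suc; z≤n; _+_; _*_; _∸_; _≤_; _<_; _<ᵇ_; s≤s⁻¹)
open import Data.Nat.Properties
open import Data.Nat.DivMod using (m<n*o⇒m/o<n)
open import Data.Bool using (Bool; true; false; T)
open import Data.Unit using (tt)
open import Data.Fin using (Fin; inject₁; fromℕ)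
open import Data.Product using (Σ; _×_; _,_; proj₁; proj₂)
open import Data.Empty using (⊥-elim)
open import Relation.Binary.PropositionalEquality using (_≡_; subst; sym)

ceilDiv-least : ∀ p q y → p ≤ y * suc q → ceilDiv p (suc q) ≤ y
ceilDiv-least p q y p≤yq = s≤s⁻¹ (m<n*o⇒m/o<n p+q<[1+y]q)
  where
  open ≤-Reasoning
  p+q<[1+y]q : p + q < suc y * suc q
  p+q<[1+y]q = begin-strict
    p + q             ≤⟨ +-monoˡ-≤ q p≤yq ⟩
    y * suc q + q     <⟨ +-monoʳ-< (y * suc q) (n<1+n q) ⟩
    y * suc q + suc q ≡⟨ +-comm (y * suc q) (suc q) ⟩
    suc y * suc q     ∎

sumFin-lower : ∀ k (f : Fin k → ℕ) lb → (∀ i → lb ≤ f i) → k * lb ≤ sumFin k f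
sumFin-lower zero    f lb f≥lb = z≤n
sumFin-lower (suc k) f lb f≥lb =
  +-mono-≤ (f≥lb Data.Fin.zero)
           (sumFin-lower k (λ i → f (Data.Fin.suc i)) lb (λ i → f≥lb (Data.Fin.suc i)))

solution-last-lower : ∀ a' k (x : Fin (suc k) → ℕ) lb →
  IsSolution (suc a') k x → (∀ i → lb ≤ x (inject₁ i)) →
  ceilDiv (k * lb) (suc a') ≤ x (fromℕ k)
solution-last-lower a' k x lb sol x≥lb = ceilDiv-least (k * lb) a' (x (fromℕ k)) k·lb≤x·a
  where
  open ≤-Reasoning
  k·lb≤x·a : k * lb ≤ x (fromℕ k) * suc a'
  k·lb≤x·a = begin
    k * lb                          ≤⟨ sumFin-lower k (λ i → x (inject₁ i)) lb x≥lb ⟩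
    sumFin k (λ i → x (inject₁ i))  ≡⟨ sol ⟩
    suc a' * x (fromℕ k)            ≡⟨ *-comm (suc a') (x (fromℕ k)) ⟩
    x (fromℕ k) * suc a'            ∎

threshold : ℕ → ℕ → Bool
threshold t x = x <ᵇ t

threshold-true : ∀ t x → threshold t x ≡ true → x < t
threshold-true t x red = <ᵇ⇒< x t (subst T (sym red) tt)

threshold-false : ∀ t x → threshold t x ≡ false → t ≤ x
threshold-false t x blue = ≮⇒≥ (λ x<t → subst T blue (<⇒<ᵇ x<t))

MonochromaticSolution : (a m n : ℕ) → (ℕ → Bool) → Set
MonochromaticSolution a m n col =
  Σ Bool λ c → Σ (Fin (suc (m ∸ 1)) → ℕ) λ x →
    InRange n (m ∸ 1) x × IsSolution a (m ∸ 1) x × Monochromatic col c (m ∸ 1) x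

proposition1 : (a m : ℕ) → 3 ≤ a → 3 ≤ m →
    (n : ℕ) → 1 ≤ n → RadoProperty a m n → C m a ≤ n
proposition1 zero     m ()
proposition1 (suc a') m _ _ n _ rado = monochromatic-is-blue (rado (threshold t))
  where
  k = m ∸ 1
  t = ceilDiv k (suc a')

  monochromatic-is-blue : MonochromaticSolution (suc a') m n (threshold t) → C m (suc a') ≤ n
  monochromatic-is-blue (true , x , range , sol , red) = ⊥-elim (<⇒≱ last<t t≤last)
    where
    last<t : x (fromℕ k) < t
    last<t = threshold-true t _ (red (fromℕ k))
    t≤last : t ≤ x (fromℕ k)
    t≤last = subst (λ s → ceilDiv s (suc a') ≤ x (fromℕ k)) (*-identityʳ k)
               (solution-last-lower a' k x 1 sol (λ i → proj₁ (range (inject₁ i))))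
  monochromatic-is-blue (false , x , range , sol , blue) = begin
    C m (suc a')  ≤⟨ solution-last-lower a' k x t sol (λ i → threshold-false t _ (blue (inject₁ i))) ⟩
    x (fromℕ k)   ≤⟨ proj₂ (range (fromℕ k)) ⟩
    n             ∎
    where open ≤-Reasoning
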